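{- Let $l\ge 2$ be an integer. The probability that $l$ independently and uniformly chosen random permutations from $\mathcal{S}_n$ fail to generate a transitive subgroup of $\mathcal{S}_n$ is bounded by \[\sum_{1\le r\le n/2}\binom{n}{r}^{1-l}\le \frac{1}{n^{l-1}}+O\left(\frac{1}{n^{l}}\right)\] as $n\to\infty$. -}

module Defs where

open import Data.Nat using (ℕ; zero; suc; _^_; _∸_)
open import Data.Nat.DivMod using (_/_)
open import Data.Nat.Combinatorics using (_C_)
open import Data.Integer using (+_)
open import Data.Rational using (ℚ; 0ℚ; _+_)
import Data.Rational as ℚ
open import Data.Fin using (Fin)
open import Data.Vec using (Vec; lookup)
open import Data.List using (List; applyUpTo; foldr; map)
open import Function.Definitions using (Injective)
open import Relation.Binary.PropositionalEquality using (_≡_)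
open import Relation.Nullary using (¬_)

-- a ÷ℕ b : the rational a/b  (convention: a ÷ℕ 0 = 0; only used with b > 0)
_÷ℕ_ : ℕ → ℕ → ℚ
a ÷ℕ zero    = 0ℚ
a ÷ℕ (suc b) = (+ a) ℚ./ suc b

IsPerm : ∀ {n} → Vec (Fin n) n → Set
IsPerm σ = Injective _≡_ _≡_ (lookup σ)

-- An l-tuple of elements of S_n (candidates; IsPerm checked separately).
Tuple : ℕ → ℕ → Set
Tuple n l = Vec (Vec (Fin n) n) l

AllPerm : ∀ {n l} → Tuple n l → Set
AllPerm {l = l} gs = (i : Fin l) → IsPerm (lookup gs i)

-- Reach gs x y : y lies in the orbit of x under the subgroup generated by gs
-- (closure under applying any generator or its inverse).
data Reach {n l : ℕ} (gs : Tuple n l) (x : Fin n) : Fin n → Set where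
  here : Reach gs x x
  fwd  : ∀ {y} (i : Fin l) → Reach gs x y → Reach gs x (lookup (lookup gs i) y)
  bwd  : ∀ {y} (i : Fin l) (z : Fin n) → Reach gs x y → lookup (lookup gs i) z ≡ y → Reach gs x z

Transitive : ∀ {n l} → Tuple n l → Set
Transitive {n} gs = (x y : Fin n) → Reach gs x y

-- ∑_{1 ≤ r ≤ n/2} binom(n,r)^{1-l}  =  ∑_{1 ≤ r ≤ ⌊n/2⌋} 1 / binom(n,r)^{l-1}
boundSum : ℕ → ℕ → ℚ
boundSum n l = foldr _+_ 0ℚ (map (λ r → 1 ÷ℕ ((n C r) ^ (l ∸ 1))) (applyUpTo suc (n / 2)))

module Submission where

-- If the group is not transitive, an orbit or its complement is an invariant
-- subset S with 1 ≤ |S| = r ≤ n/2.  A permutation preserving S is determined by its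
-- restrictions to S and to the complement, so at most r!(n-r)! permutations preserve S and
-- at most C(n,r)(r!(n-r)!)^l tuples leave some r-set invariant; dividing by (n!)^l gives the
-- r-th term.  Orbits are used under a double negation, which is harmless as
-- the existence of a small invariant subset is decidable.  For n ≥ 6 the term r = 1 is n^(1-l), the term r = 2 is at most
-- 4^(l-1) n^(-l) as n² ≤ 4 C(n,2), and the fewer than n remaining terms are each at most
-- C(n,3)^(1-l), which is small as n³ ≤ 27 C(n,3).

open import Defs
open import Data.Bool using (true; false; not)
import Data.Bool.Properties as Bool
open import Data.Empty using (⊥-elim)
open import Data.Fin using (Fin) renaming (zero to fzero; suc to fsuc)
open import Data.Fin.Subset using (Subset; ∁)
import Data.Fin.Properties as Fin
open import Data.List
  using (List; []; _∷_; _++_; head; length; map; filter; drop; deduplicate; applyUpTo; foldr)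
open import Data.List.Properties using (length-map; length-++; filter-notAll)
import Data.List.Properties as List
open import Data.List.Membership.Propositional using (_∈_; lose)
open import Data.List.Membership.Propositional.Properties
  using ( ∈-map⁺; ∈-map⁻; ∈-++⁺ˡ; ∈-++⁺ʳ; ∈-++⁻; ∈-deduplicate⁺; ∈-deduplicate⁻; ∈-filter⁺
        ; ∈-applyUpTo⁺; ∈-applyUpTo⁻; ∈-length)
open import Data.List.Relation.Unary.All using (All; []; _∷_)
import Data.List.Relation.Unary.All as All
import Data.List.Relation.Unary.All.Properties as All
open import Data.List.Relation.Unary.Any using (Any; here; there)
import Data.List.Relation.Unary.Any as Any
open import Data.List.Relation.Unary.Unique.Propositional using (Unique; []; _∷_)
import Data.List.Relation.Unary.Unique.Propositional.Properties as Unique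
open import Data.List.Relation.Unary.Unique.DecPropositional.Properties using (deduplicate-!)
open import Data.Maybe using (just)
import Data.Maybe.Properties as Maybe
open import Data.Nat using (ℕ; zero; suc; _+_; _*_; _∸_; _^_; _!; _≤_; _<_; z≤n; s≤s; >-nonZero)
open import Data.Nat.Combinatorics using (_C_; nCk+nC[k+1]≡[n+1]C[k+1]; nC1≡n; k![n∸k]!∣n!)
open import Data.Nat.Combinatorics.Specification using (nCk≡n!/k![n-k]!)
open import Data.Nat.DivMod using (_/_; m*n/n≡m; m/n*n≡m; m/n*n≤m; m/n≤m; /-monoˡ-≤)
open import Data.Nat.ListAction using (sum)
open import Data.Nat.Properties
open import Data.Product using (Σ; _×_; _,_; proj₁; proj₂)
open import Data.Sum using (_⊎_; inj₁; inj₂)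
open import Data.Vec using (Vec; lookup; tabulate) renaming ([] to []ᵛ; _∷_ to _∷ᵛ_)
import Data.Vec.Properties as Vec
open import Data.Rational using (ℚ; 0ℚ)
import Data.Rational as ℚ
import Data.Rational.Properties as ℚ
import Data.Rational.Unnormalised as ℚᵘ
import Data.Rational.Unnormalised.Properties as ℚᵘ
import Data.Integer as ℤ
import Data.Integer.Properties as ℤ
open import Data.Nat.Tactic.RingSolver using (solve-∀)
open import Function using (id; _∘_)
open import Relation.Binary using (DecidableEquality)
open import Relation.Binary.PropositionalEquality
open import Relation.Nullary using (Dec; yes; no; does; ¬_; ¬?)
open import Relation.Nullary.Decidable
  using (does-⇔; dec-true; dec-false; decidable-stable; ¬¬-excluded-middle)
open import Function.Bundles using (_⇔_; mk⇔)

AtMost : {A : Set} → (A → Set) → ℕ → Set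
AtMost {A} P K = (xs : List A) → Unique xs → All P xs → length xs ≤ K

module _ {A : Set} {P : A → Set} where

  atMost-one : (∀ {x y} → P x → P y → x ≡ y) → AtMost P 1
  atMost-one unique []           _                   _              = z≤n
  atMost-one unique (x ∷ [])     _                   _              = s≤s z≤n
  atMost-one unique (x ∷ y ∷ xs) ((x≢y ∷ _) ∷ _) (px ∷ py ∷ _) = ⊥-elim (x≢y (unique px py))

  atMost-injection : ∀ {B : Set} {Q : B → Set} {K} (f : A → B) →
    (∀ {x y} → P x → P y → f x ≡ f y → x ≡ y) → (∀ {x} → P x → Q (f x)) →
    AtMost Q K → AtMost P K
  atMost-injection f f-inj f-maps bound xs xs! pxs =
    subst (_≤ _) (length-map f xs) (bound (map f xs) (map-unique xs! pxs) (All.map⁺ (All.map f-maps pxs)))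
    where
    map-unique : ∀ {xs} → Unique xs → All P xs → Unique (map f xs)
    map-unique []           []         = []
    map-unique (x∉ ∷ xs!) (px ∷ pxs) =
      All.map⁺ (All.zipWith (λ (x≢y , py) fx≡fy → x≢y (f-inj px py fx≡fy)) (x∉ , pxs))
      ∷ map-unique xs! pxs

  atMost-weaken : ∀ {Q : A → Set} {K} → (∀ {x} → P x → Q x) → AtMost Q K → AtMost P K
  atMost-weaken = atMost-injection id (λ _ _ x≡y → x≡y)

sum-mono : ∀ {K : Set} (ks : List K) {f g : K → ℕ} → (∀ k → k ∈ ks → f k ≤ g k) →
  sum (map f ks) ≤ sum (map g ks)
sum-mono []       f≤g = z≤n
sum-mono (k ∷ ks) f≤g = +-mono-≤ (f≤g k (here refl)) (sum-mono ks (λ k′ k′∈ → f≤g k′ (there k′∈)))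

sum-const : ∀ {K : Set} (ks : List K) c → sum (map (λ _ → c) ks) ≡ length ks * c
sum-const []       c = refl
sum-const (k ∷ ks) c = cong (c +_) (sum-const ks c)

module Fibres {A K : Set} (R : A → K → Set) (R? : ∀ x k → Dec (R x k)) where

  fibre : List A → K → List A
  fibre xs k = filter (λ x → R? x k) xs

  fibreSizes : List K → List A → ℕ
  fibreSizes ks xs = sum (map (λ k → length (fibre xs k)) ks)

  fibre-∷ : ∀ x xs k → length (fibre xs k) ≤ length (fibre (x ∷ xs) k)
  fibre-∷ x xs k with R? x k
  ... | yes _ = n≤1+n _
  ... | no  _ = ≤-refl

  fibreSizes-∷ : ∀ ks x xs → fibreSizes ks xs ≤ fibreSizes ks (x ∷ xs)
  fibreSizes-∷ ks x xs = sum-mono ks (λ k _ → fibre-∷ x xs k)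

  fibreSizes-∷-key : ∀ ks x xs → Any (R x) ks → suc (fibreSizes ks xs) ≤ fibreSizes ks (x ∷ xs)
  fibreSizes-∷-key (k ∷ ks) x xs (here r) with R? x k
  ... | yes _ = s≤s (+-monoʳ-≤ _ (fibreSizes-∷ ks x xs))
  ... | no ¬r = ⊥-elim (¬r r)
  fibreSizes-∷-key (k ∷ ks) x xs (there r) =
    ≤-trans (≤-reflexive (sym (+-suc _ _))) (+-mono-≤ (fibre-∷ x xs k) (fibreSizes-∷-key ks x xs r))

  length≤fibreSizes : ∀ ks xs → All (λ x → Any (R x) ks) xs → length xs ≤ fibreSizes ks xs
  length≤fibreSizes ks []       _            = z≤n
  length≤fibreSizes ks (x ∷ xs) (key ∷ keys) =
    ≤-trans (s≤s (length≤fibreSizes ks xs keys)) (fibreSizes-∷-key ks x xs key)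

  atMost-fibres : ∀ {P : A → Set} ks (f : K → ℕ) → (∀ {x} → P x → Any (R x) ks) →
    (∀ k → k ∈ ks → AtMost (λ x → P x × R x k) (f k)) → AtMost P (sum (map f ks))
  atMost-fibres ks f key bound xs xs! pxs =
    ≤-trans (length≤fibreSizes ks xs (All.map key pxs))
            (sum-mono ks (λ k k∈ → bound k k∈ (fibre xs k) (Unique.filter⁺ (λ x → R? x k) xs!)
               (All.zip (All.filter⁺ (λ x → R? x k) pxs , All.all-filter (λ x → R? x k) xs))))

  atMost-uniformFibres : ∀ {P : A → Set} ks K → (∀ {x} → P x → Any (R x) ks) →
    (∀ k → k ∈ ks → AtMost (λ x → P x × R x k) K) → AtMost P (length ks * K)
  atMost-uniformFibres ks K key bound xs xs! pxs =
    subst (length xs ≤_) (sum-const ks K) (atMost-fibres ks (λ _ → K) key bound xs xs! pxs)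

atMost-× : ∀ {A B : Set} {P : A → Set} {Q : B → Set} {K₁ K₂} → DecidableEquality A →
  AtMost P K₁ → AtMost Q K₂ → AtMost (λ (p : A × B) → P (proj₁ p) × Q (proj₂ p)) (K₁ * K₂)
atMost-× {A} {B} {P} {Q} {K₁} {K₂} _≟_ boundP boundQ xs xs! pxs =
  ≤-trans (atMost-uniformFibres firsts K₂ proj₂ fibre-bound xs xs! (All.tabulate first-listed))
          (*-monoˡ-≤ K₂ (boundP firsts (deduplicate-! _≟_ (map proj₁ xs)) (All.tabulate firsts-P)))
  where
  open Fibres (λ (p : A × B) a → proj₁ p ≡ a) (λ p a → proj₁ p ≟ a)
  firsts : List A
  firsts = deduplicate _≟_ (map proj₁ xs)
  first-listed : ∀ {p} → p ∈ xs → (P (proj₁ p) × Q (proj₂ p)) × proj₁ p ∈ firsts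
  first-listed p∈ = All.lookup pxs p∈ , ∈-deduplicate⁺ _≟_ (∈-map⁺ proj₁ p∈)
  firsts-P : ∀ {a} → a ∈ firsts → P a
  firsts-P a∈ with ∈-map⁻ proj₁ (∈-deduplicate⁻ _≟_ (map proj₁ xs) a∈)
  ... | p , p∈ , refl = proj₁ (All.lookup pxs p∈)
  -- within the fibre of a, a pair is determined by its second component
  fibre-bound : ∀ a → a ∈ firsts →
    AtMost (λ p → ((P (proj₁ p) × Q (proj₂ p)) × proj₁ p ∈ firsts) × proj₁ p ≡ a) K₂
  fibre-bound a _ = atMost-injection proj₂ same-first (proj₂ ∘ proj₁ ∘ proj₁) boundQ
    where
    same-first : ∀ {p p′ : A × B} {X X′ : Set} →
      X × proj₁ p ≡ a → X′ × proj₁ p′ ≡ a → proj₂ p ≡ proj₂ p′ → p ≡ p′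
    same-first (_ , refl) (_ , refl) refl = refl

atMost-Vec : ∀ {A : Set} {P : A → Set} {K} → DecidableEquality A → AtMost P K →
  ∀ l → AtMost (λ (v : Vec A l) → ∀ i → P (lookup v i)) (K ^ l)
atMost-Vec _≟_ boundP zero = atMost-one λ {v} {w} _ _ → empty v w
  where
  empty : ∀ {A : Set} (v w : Vec A 0) → v ≡ w
  empty []ᵛ []ᵛ = refl
atMost-Vec {A} {P} _≟_ boundP (suc l) =
  atMost-injection uncons (λ _ _ → uncons-injective) (λ {v} → entries {v})
    (atMost-× _≟_ boundP (atMost-Vec _≟_ boundP l))
  where
  uncons : Vec A (suc l) → A × Vec A l
  uncons (a ∷ᵛ v) = a , v
  uncons-injective : ∀ {v w} → uncons v ≡ uncons w → v ≡ w
  uncons-injective {_ ∷ᵛ _} {_ ∷ᵛ _} refl = refl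
  entries : ∀ {v} → (∀ i → P (lookup v i)) →
    P (proj₁ (uncons v)) × (∀ i → P (lookup (proj₂ (uncons v)) i))
  entries {_ ∷ᵛ _} p = p fzero , p ∘ fsuc

falling : ℕ → ℕ → ℕ
falling b zero    = 1
falling b (suc k) = b * falling (b ∸ 1) k

falling-! : ∀ r → falling r r ≡ r !
falling-! zero    = refl
falling-! (suc r) = cong (suc r *_) (falling-! r)

InjectiveSeq : ∀ {A : Set} → List A → ℕ → List A → Set
InjectiveSeq B k t = length t ≡ k × Unique t × All (_∈ B) t

-- There are at most b (b - 1) ⋯ (b - k + 1) of them when B has at most b entries:
-- fibre over the first entry h, and drop it, leaving a sequence in B without h.
atMost-InjectiveSeq : ∀ {A : Set} → DecidableEquality A →
  ∀ k b (B : List A) → length B ≤ b → AtMost (InjectiveSeq B k) (falling b k)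
atMost-InjectiveSeq _≟_ zero b B _ = atMost-one λ (len , _) (len′ , _) → empty len len′
  where
  empty : ∀ {A : Set} {t t′ : List A} → length t ≡ 0 → length t′ ≡ 0 → t ≡ t′
  empty {t = []} {[]} _ _ = refl
atMost-InjectiveSeq {A} _≟_ (suc k) b B |B|≤b xs xs! pxs =
  ≤-trans (atMost-uniformFibres B (falling (b ∸ 1) k) head∈B fibre-bound xs xs! pxs)
          (*-monoˡ-≤ _ |B|≤b)
  where
  open Fibres (λ t h → head t ≡ just h) (λ t h → Maybe.≡-dec _≟_ (head t) (just h))
  head∈B : ∀ {t} → InjectiveSeq B (suc k) t → Any (λ h → head t ≡ just h) B
  head∈B {_ ∷ _} (_ , _ , h∈B ∷ _) = Any.map (cong just) h∈B
  fibre-bound : ∀ h → h ∈ B →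
    AtMost (λ t → InjectiveSeq B (suc k) t × head t ≡ just h) (falling (b ∸ 1) k)
  fibre-bound h h∈B = atMost-injection (drop 1) same-head drop-head
    (atMost-InjectiveSeq _≟_ k (b ∸ 1) B-h |B-h|≤b-1)
    where
    ≢h? : ∀ y → Dec (¬ y ≡ h)
    ≢h? y = ¬? (y ≟ h)
    B-h : List A
    B-h = filter ≢h? B
    |B-h|≤b-1 : length B-h ≤ b ∸ 1
    |B-h|≤b-1 = ≤-trans (pred-mono-≤ (filter-notAll ≢h? B (Any.map (λ h≡y y≢h → y≢h (sym h≡y)) h∈B)))
                        (∸-monoˡ-≤ 1 |B|≤b)
    same-head : ∀ {t t′} → InjectiveSeq B (suc k) t × head t ≡ just h →
      InjectiveSeq B (suc k) t′ × head t′ ≡ just h → drop 1 t ≡ drop 1 t′ → t ≡ t′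
    same-head {_ ∷ _} {_ ∷ _} (_ , refl) (_ , refl) refl = refl
    drop-head : ∀ {t} → InjectiveSeq B (suc k) t × head t ≡ just h → InjectiveSeq B-h k (drop 1 t)
    drop-head {_ ∷ t} ((len , h∉t ∷ t! , _ ∷ t⊆B) , refl) =
      suc-injective len , t! , All.zipWith (λ (h≢y , y∈B) → ∈-filter⁺ ≢h? y∈B (h≢y ∘ sym)) (h∉t , t⊆B)

members : ∀ {n} → Subset n → List (Fin n)
members []ᵛ          = []
members (true  ∷ᵛ S) = fzero ∷ map fsuc (members S)
members (false ∷ᵛ S) = map fsuc (members S)

members-complete : ∀ {n} (S : Subset n) z → lookup S z ≡ true → z ∈ members S
members-complete (true  ∷ᵛ S) fzero    _    = here refl
members-complete (true  ∷ᵛ S) (fsuc z) z∈S = there (∈-map⁺ fsuc (members-complete S z z∈S))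
members-complete (false ∷ᵛ S) (fsuc z) z∈S = ∈-map⁺ fsuc (members-complete S z z∈S)

members-sound : ∀ {n} (S : Subset n) z → z ∈ members S → lookup S z ≡ true
members-sound (true  ∷ᵛ S) fzero    _           = refl
members-sound (false ∷ᵛ S) fzero    z∈          with ∈-map⁻ fsuc z∈
... | _ , _ , ()
members-sound (true  ∷ᵛ S) (fsuc z) (there z∈) with ∈-map⁻ fsuc z∈
... | _ , z∈′ , refl = members-sound S _ z∈′
members-sound (false ∷ᵛ S) (fsuc z) z∈          with ∈-map⁻ fsuc z∈
... | _ , z∈′ , refl = members-sound S _ z∈′

members-unique : ∀ {n} (S : Subset n) → Unique (members S)
members-unique []ᵛ          = []
members-unique (true  ∷ᵛ S) =
  All.map⁺ (All.tabulate (λ _ ())) ∷ Unique.map⁺ Fin.suc-injective (members-unique S)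
members-unique (false ∷ᵛ S) = Unique.map⁺ Fin.suc-injective (members-unique S)

members-∁ : ∀ {n} (S : Subset n) → length (members S) + length (members (∁ S)) ≡ n
members-∁ []ᵛ = refl
members-∁ (true ∷ᵛ S)
  rewrite length-map fsuc (members S) | length-map fsuc (members (∁ S)) = cong suc (members-∁ S)
members-∁ (false ∷ᵛ S)
  rewrite length-map fsuc (members S) | length-map fsuc (members (∁ S)) =
  trans (+-suc _ _) (cong suc (members-∁ S))

subsetsOfSize : (n r : ℕ) → List (Subset n)
subsetsOfSize zero    zero    = []ᵛ ∷ []
subsetsOfSize zero    (suc r) = []
subsetsOfSize (suc n) zero    = map (false ∷ᵛ_) (subsetsOfSize n zero)
subsetsOfSize (suc n) (suc r) =
  map (true ∷ᵛ_) (subsetsOfSize n r) ++ map (false ∷ᵛ_) (subsetsOfSize n (suc r))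

length-subsetsOfSize : ∀ n r → length (subsetsOfSize n r) ≡ n C r
length-subsetsOfSize zero    zero    = refl
length-subsetsOfSize zero    (suc r) = refl
length-subsetsOfSize (suc n) zero    =
  trans (length-map _ (subsetsOfSize n zero)) (length-subsetsOfSize n zero)
length-subsetsOfSize (suc n) (suc r) = begin
  length (map (true ∷ᵛ_) (subsetsOfSize n r) ++ map (false ∷ᵛ_) (subsetsOfSize n (suc r)))
    ≡⟨ length-++ (map (true ∷ᵛ_) (subsetsOfSize n r)) ⟩
  length (map (true ∷ᵛ_) (subsetsOfSize n r)) + length (map (false ∷ᵛ_) (subsetsOfSize n (suc r)))
    ≡⟨ cong₂ _+_ (length-map _ (subsetsOfSize n r)) (length-map _ (subsetsOfSize n (suc r))) ⟩
  length (subsetsOfSize n r) + length (subsetsOfSize n (suc r))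
    ≡⟨ cong₂ _+_ (length-subsetsOfSize n r) (length-subsetsOfSize n (suc r)) ⟩
  n C r + n C suc r
    ≡⟨ nCk+nC[k+1]≡[n+1]C[k+1] n r ⟩
  suc n C suc r ∎
  where open ≡-Reasoning

subsetsOfSize-sound : ∀ n r (S : Subset n) → S ∈ subsetsOfSize n r → length (members S) ≡ r
subsetsOfSize-sound zero    zero    .[]ᵛ (here refl) = refl
subsetsOfSize-sound (suc n) zero    S    S∈ with ∈-map⁻ (false ∷ᵛ_) S∈
... | S′ , S′∈ , refl = trans (length-map fsuc (members S′)) (subsetsOfSize-sound n zero S′ S′∈)
subsetsOfSize-sound (suc n) (suc r) S    S∈ with ∈-++⁻ (map (true ∷ᵛ_) (subsetsOfSize n r)) S∈
... | inj₁ S∈₁ with ∈-map⁻ (true ∷ᵛ_) S∈₁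
...   | S′ , S′∈ , refl = cong suc (trans (length-map fsuc (members S′)) (subsetsOfSize-sound n r S′ S′∈))
subsetsOfSize-sound (suc n) (suc r) S    S∈ | inj₂ S∈₂ with ∈-map⁻ (false ∷ᵛ_) S∈₂
...   | S′ , S′∈ , refl = trans (length-map fsuc (members S′)) (subsetsOfSize-sound n (suc r) S′ S′∈)

subsetsOfSize-complete : ∀ {n} (S : Subset n) → S ∈ subsetsOfSize n (length (members S))
subsetsOfSize-complete []ᵛ = here refl
subsetsOfSize-complete {suc n} (true ∷ᵛ S) rewrite length-map fsuc (members S) =
  ∈-++⁺ˡ (∈-map⁺ (true ∷ᵛ_) (subsetsOfSize-complete S))
subsetsOfSize-complete {suc n} (false ∷ᵛ S) rewrite length-map fsuc (members S) =
  outside (length (members S)) (subsetsOfSize-complete S)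
  where
  outside : ∀ r → S ∈ subsetsOfSize n r → (false ∷ᵛ S) ∈ subsetsOfSize (suc n) r
  outside zero    S∈ = ∈-map⁺ (false ∷ᵛ_) S∈
  outside (suc r) S∈ = ∈-++⁺ʳ (map (true ∷ᵛ_) (subsetsOfSize n r)) (∈-map⁺ (false ∷ᵛ_) S∈)

smaller-≤-half : ∀ {a b n} → a ≤ b → a + b ≡ n → a ≤ n / 2
smaller-≤-half {a} {b} {n} a≤b a+b≡n = begin
  a         ≡⟨ m*n/n≡m a 2 ⟨
  a * 2 / 2 ≤⟨ /-monoˡ-≤ 2 a*2≤n ⟩
  n / 2     ∎
  where
  open ≤-Reasoning
  a*2≤n : a * 2 ≤ n
  a*2≤n = begin
    a * 2       ≡⟨ *-comm a 2 ⟩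
    a + (a + 0) ≡⟨ cong (a +_) (+-identityʳ a) ⟩
    a + a       ≤⟨ +-monoʳ-≤ a a≤b ⟩
    a + b       ≡⟨ a+b≡n ⟩
    n           ∎

one-≤-half : ∀ {a b n} → a + b ≡ n → a ≤ n / 2 ⊎ b ≤ n / 2
one-≤-half {a} {b} a+b≡n with ≤-total a b
... | inj₁ a≤b = inj₁ (smaller-≤-half a≤b a+b≡n)
... | inj₂ b≤a = inj₂ (smaller-≤-half b≤a (trans (+-comm b a) a+b≡n))

∈-upToHalf : ∀ {n r} → r ∈ applyUpTo suc (n / 2) → r ≤ n / 2
∈-upToHalf r∈ with ∈-applyUpTo⁻ suc r∈
... | _ , i<n/2 , refl = i<n/2

+-≤-halves : ∀ {a b n} → a ≤ b → b ≤ n / 2 → a + b ≤ n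
+-≤-halves {a} {b} {n} a≤b b≤n/2 = begin
  a + b       ≤⟨ +-monoˡ-≤ b a≤b ⟩
  b + b       ≡⟨ cong (b +_) (+-identityʳ b) ⟨
  2 * b       ≡⟨ *-comm 2 b ⟩
  b * 2       ≤⟨ *-monoˡ-≤ 2 b≤n/2 ⟩
  n / 2 * 2   ≤⟨ m/n*n≤m n 2 ⟩
  n           ∎
  where open ≤-Reasoning

Preserves : ∀ {n} → Subset n → Vec (Fin n) n → Set
Preserves S σ = ∀ z → lookup S (lookup σ z) ≡ lookup S z

preserves-∁ : ∀ {n} (S : Subset n) {σ} → Preserves S σ → Preserves (∁ S) σ
preserves-∁ S {σ} pres z = begin
  lookup (∁ S) (lookup σ z)   ≡⟨ Vec.lookup-map _ not S ⟩
  not (lookup S (lookup σ z)) ≡⟨ cong not (pres z) ⟩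
  not (lookup S z)            ≡⟨ Vec.lookup-map z not S ⟨
  lookup (∁ S) z              ∎
  where open ≡-Reasoning

¬¬-∀-Fin : ∀ {n} {P : Fin n → Set} → (∀ z → ¬ ¬ P z) → ¬ ¬ (∀ z → P z)
¬¬-∀-Fin {zero}      ¬¬P ¬∀P = ¬∀P (λ ())
¬¬-∀-Fin {suc n} {P} ¬¬P ¬∀P =
  ¬¬P fzero λ P0 → ¬¬-∀-Fin {n} {P ∘ fsuc} (¬¬P ∘ fsuc) λ Psuc →
    ¬∀P λ { fzero → P0 ; (fsuc z) → Psuc z }

module _ {n l : ℕ} (gs : Tuple n l) where

  Invariant : Subset n → Set
  Invariant S = ∀ i → Preserves S (lookup gs i)

  invariant? : ∀ S → Dec (Invariant S)
  invariant? S = Fin.all? λ i → Fin.all? λ z → lookup S (lookup (lookup gs i) z) Bool.≟ lookup S z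

  HasSmallInvariantSubset : Set
  HasSmallInvariantSubset = Any (λ r → Any Invariant (subsetsOfSize n r)) (applyUpTo suc (n / 2))

  hasSmallInvariantSubset? : Dec HasSmallInvariantSubset
  hasSmallInvariantSubset? =
    Any.any? (λ r → Any.any? invariant? (subsetsOfSize n r)) (applyUpTo suc (n / 2))

  smallInvariantSubset : ∀ S → Invariant S → 0 < length (members S) → length (members S) ≤ n / 2 →
    HasSmallInvariantSubset
  smallInvariantSubset S inv _ |S|≤n/2 with length (members S) in |S|≡r
  ... | suc _ = lose (∈-applyUpTo⁺ suc |S|≤n/2)
                     (lose (subst (λ r → S ∈ subsetsOfSize n r) |S|≡r (subsetsOfSize-complete S)) inv)

  module Orbit (x : Fin n) (reach? : ∀ z → Dec (Reach gs x z)) where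

    orbit : Subset n
    orbit = tabulate (does ∘ reach?)

    -- z and its image under a generator are reachable from x together
    orbit-invariant : Invariant orbit
    orbit-invariant i z = begin
      lookup orbit (lookup (lookup gs i) z) ≡⟨ Vec.lookup∘tabulate (does ∘ reach?) _ ⟩
      does (reach? (lookup (lookup gs i) z)) ≡⟨ does-⇔ reach-step (reach? _) (reach? z) ⟩
      does (reach? z)                        ≡⟨ Vec.lookup∘tabulate (does ∘ reach?) z ⟨
      lookup orbit z                         ∎
      where
      open ≡-Reasoning
      reach-step : Reach gs x (lookup (lookup gs i) z) ⇔ Reach gs x z
      reach-step = mk⇔ (λ r → bwd i z r refl) (fwd i)

    x∈orbit : x ∈ members orbit
    x∈orbit = members-complete orbit x (trans (Vec.lookup∘tabulate _ x) (dec-true (reach? x) here))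

    unreachable∈∁orbit : ∀ {y} → ¬ Reach gs x y → y ∈ members (∁ orbit)
    unreachable∈∁orbit {y} ¬reach = members-complete (∁ orbit) y (begin
      lookup (∁ orbit) y ≡⟨ Vec.lookup-map y not orbit ⟩
      not (lookup orbit y) ≡⟨ cong not (Vec.lookup∘tabulate _ y) ⟩
      not (does (reach? y)) ≡⟨ cong not (dec-false (reach? y) ¬reach) ⟩
      true ∎)
      where open ≡-Reasoning

    orbit-small : ∀ {y} → ¬ Reach gs x y → HasSmallInvariantSubset
    orbit-small ¬reach with one-≤-half (members-∁ orbit)
    ... | inj₁ small = smallInvariantSubset orbit orbit-invariant (∈-length x∈orbit) small
    ... | inj₂ small =
      smallInvariantSubset (∁ orbit) (λ i → preserves-∁ orbit {lookup gs i} (orbit-invariant i))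
        (∈-length (unreachable∈∁orbit ¬reach)) small

  -- Constructively, the orbit
  -- of x need not be decidable, but being decidable is not refutable; as the goal
  -- is decidable, its double negation suffices.
  nonTransitive⇒smallInvariantSubset : ¬ Transitive gs → HasSmallInvariantSubset
  nonTransitive⇒smallInvariantSubset ¬trans =
    decidable-stable hasSmallInvariantSubset? λ ¬small →
      ¬¬-∀-Fin (λ x → ¬¬-∀-Fin λ y ¬reach →
        ¬¬-∀-Fin (λ z → ¬¬-excluded-middle) λ reach? → ¬small (Orbit.orbit-small x reach? ¬reach)) ¬trans

lookup-extensional : ∀ {A : Set} {n} (v w : Vec A n) → (∀ z → lookup v z ≡ lookup w z) → v ≡ w
lookup-extensional v w v≗w = begin
  v                  ≡⟨ Vec.tabulate∘lookup v ⟨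
  tabulate (lookup v) ≡⟨ Vec.tabulate-cong v≗w ⟩
  tabulate (lookup w) ≡⟨ Vec.tabulate∘lookup w ⟩
  w                  ∎
  where open ≡-Reasoning

map-≡⇒agree : ∀ {A B : Set} (f g : A → B) {zs} → map f zs ≡ map g zs → ∀ {z} → z ∈ zs → f z ≡ g z
map-≡⇒agree f g {_ ∷ _}  fzs≡gzs (here refl) = List.∷-injectiveˡ fzs≡gzs
map-≡⇒agree f g {_ ∷ zs} fzs≡gzs (there z∈)  = map-≡⇒agree f g {zs} (List.∷-injectiveʳ fzs≡gzs) z∈

module _ {n : ℕ} where

  restriction : ∀ (S : Subset n) σ → IsPerm σ → Preserves S σ →
    InjectiveSeq (members S) (length (members S)) (map (lookup σ) (members S))
  restriction S σ perm pres =
      length-map (lookup σ) (members S)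
    , Unique.map⁺ perm (members-unique S)
    , All.map⁺ (All.tabulate λ {z} z∈S →
        members-complete S (lookup σ z) (trans (pres z) (members-sound S z z∈S)))

  restrictions-injective : ∀ (S : Subset n) {σ τ : Vec (Fin n) n} →
    (map (lookup σ) (members S) , map (lookup σ) (members (∁ S))) ≡
    (map (lookup τ) (members S) , map (lookup τ) (members (∁ S))) → σ ≡ τ
  restrictions-injective S {σ} {τ} same = lookup-extensional σ τ agree
    where
    agree : ∀ z → lookup σ z ≡ lookup τ z
    agree z with lookup S z in z∈?S
    ... | true  = map-≡⇒agree (lookup σ) (lookup τ) (cong proj₁ same) (members-complete S z z∈?S)
    ... | false = map-≡⇒agree (lookup σ) (lookup τ) (cong proj₂ same)
                    (members-complete (∁ S) z (trans (Vec.lookup-map z not S) (cong not z∈?S)))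

  atMost-preserving : ∀ (S : Subset n) r → length (members S) ≡ r →
    AtMost (λ σ → IsPerm σ × Preserves S σ) (r ! * (n ∸ r) !)
  atMost-preserving S r |S|≡r = subst (AtMost _) (cong₂ _*_ |S|! |∁S|!)
    (atMost-injection (λ σ → map (lookup σ) (members S) , map (lookup σ) (members (∁ S)))
      (λ _ _ → restrictions-injective S)
      (λ {σ} (perm , pres) →
        restriction S σ perm pres , restriction (∁ S) σ perm (preserves-∁ S {σ} pres))
      (atMost-× (List.≡-dec Fin._≟_) (atMost-InjectiveSeq Fin._≟_ a a (members S) ≤-refl)
                                      (atMost-InjectiveSeq Fin._≟_ b b (members (∁ S)) ≤-refl)))
    where
    a b : ℕ
    a = length (members S)
    b = length (members (∁ S))
    |S|! : falling a a ≡ r !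
    |S|! = trans (falling-! a) (cong _! |S|≡r)
    |∁S|! : falling b b ≡ (n ∸ r) !
    |∁S|! = trans (falling-! b) (cong _! (trans (sym (m+n∸m≡n a b)) (cong₂ _∸_ (members-∁ S) |S|≡r)))

atMost-invariantTuples : ∀ {n} l (S : Subset n) r → length (members S) ≡ r →
  AtMost (λ (gs : Tuple n l) → AllPerm gs × Invariant gs S) ((r ! * (n ∸ r) !) ^ l)
atMost-invariantTuples l S r |S|≡r =
  atMost-weaken (λ (perms , inv) i → perms i , inv i)
    (atMost-Vec (Vec.≡-dec Fin._≟_) (atMost-preserving S r |S|≡r) l)

-- Group the tuples by the size r of a small invariant
-- subset, then by the subset itself.
nonTransitiveBound : ℕ → ℕ → ℕ → ℕ
nonTransitiveBound n l r = (n C r) * (r ! * (n ∸ r) !) ^ l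

atMost-nonTransitive : ∀ n l →
  AtMost (λ (gs : Tuple n l) → AllPerm gs × ¬ Transitive gs)
         (sum (map (nonTransitiveBound n l) (applyUpTo suc (n / 2))))
atMost-nonTransitive n l =
  atMost-fibres (applyUpTo suc (n / 2)) (nonTransitiveBound n l)
    (λ {gs} (_ , ¬trans) → nonTransitive⇒smallInvariantSubset gs ¬trans) size-bound
  where
  open Fibres (λ (gs : Tuple n l) r → Any (Invariant gs) (subsetsOfSize n r))
              (λ gs r → Any.any? (invariant? gs) (subsetsOfSize n r))
  size-bound : ∀ r → r ∈ applyUpTo suc (n / 2) →
    AtMost (λ gs → (AllPerm gs × ¬ Transitive gs) × Any (Invariant gs) (subsetsOfSize n r))
           (nonTransitiveBound n l r)
  size-bound r _ = subst (AtMost _) (cong (_* (r ! * (n ∸ r) !) ^ l) (length-subsetsOfSize n r))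
    (Fibres.atMost-uniformFibres Invariant invariant? (subsetsOfSize n r) ((r ! * (n ∸ r) !) ^ l) proj₂
      λ S S∈ → atMost-weaken (λ (((perms , _) , _) , inv) → perms , inv)
                 (atMost-invariantTuples l S r (subsetsOfSize-sound n r S S∈)))

*-^ : ∀ x y k → (x * y) ^ k ≡ x ^ k * y ^ k
*-^ x y zero    = refl
*-^ x y (suc k) = trans (cong ((x * y) *_) (*-^ x y k)) (rearrange x y (x ^ k) (y ^ k))
  where
  rearrange : ∀ x y X Y → x * y * (X * Y) ≡ x * X * (y * Y)
  rearrange = solve-∀

binomial-factorials : ∀ {n r} → r ≤ n → (n C r) * (r ! * (n ∸ r) !) ≡ n !
binomial-factorials {n} {r} r≤n = begin
  (n C r) * (r ! * (n ∸ r) !)                    ≡⟨ cong (_* (r ! * (n ∸ r) !)) (nCk≡n!/k![n-k]! r≤n) ⟩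
  n ! / (r ! * (n ∸ r) !) * (r ! * (n ∸ r) !)   ≡⟨ m/n*n≡m (k![n∸k]!∣n! r≤n) ⟩
  n !                                            ∎
  where
  open ≡-Reasoning
  instance _ = r !* (n ∸ r) !≢0

binomial-pos : ∀ {n r} → r ≤ n → 0 < n C r
binomial-pos {n} {r} r≤n = n≢0⇒n>0 λ C≡0 →
  <⇒≢ (1≤n! n) (trans (cong (_* (r ! * (n ∸ r) !)) (sym C≡0)) (binomial-factorials r≤n))

-- Binomial coefficients grow towards the middle: C(n,k) ≤ C(n,r) when k ≤ r ≤ n - k.
-- Pascal's rule reduces the strict case to smaller n.
binomial-mono   : ∀ n k r → k ≤ r → k + r ≤ n → n C k ≤ n C r
binomial-mono-< : ∀ n k r → k < r → k + r ≤ n → n C k ≤ n C r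

binomial-mono n k r k≤r k+r≤n with m≤n⇒m<n∨m≡n k≤r
... | inj₁ k<r  = binomial-mono-< n k r k<r k+r≤n
... | inj₂ refl = ≤-refl

binomial-mono-< n       zero    r       _         r≤n         = binomial-pos r≤n
binomial-mono-< (suc n) (suc k) (suc r) (s≤s k<r) (s≤s k+r≤n) =
  subst₂ _≤_ (nCk+nC[k+1]≡[n+1]C[k+1] n k)
             (trans (+-comm (n C suc r) (n C r)) (nCk+nC[k+1]≡[n+1]C[k+1] n r))
    (+-mono-≤ (binomial-mono n k (suc r) (≤-trans (<⇒≤ k<r) (n≤1+n r)) k+r≤n)
              (binomial-mono n (suc k) r k<r (subst (_≤ n) (+-suc k r) k+r≤n)))

binomial-2 : ∀ n → 2 * (n C 2) + n ≡ n * n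
binomial-2 zero    = refl
binomial-2 (suc m) = begin
  2 * (suc m C 2) + suc m               ≡⟨ cong (λ t → 2 * t + suc m) (sym pascal) ⟩
  2 * (m + m C 2) + suc m               ≡⟨ regroup m (m C 2) ⟩
  (2 * (m C 2) + m) + (2 * m + 1)       ≡⟨ cong (_+ (2 * m + 1)) (binomial-2 m) ⟩
  m * m + (2 * m + 1)                   ≡⟨ square m ⟩
  suc m * suc m                         ∎
  where
  open ≡-Reasoning
  pascal : m + m C 2 ≡ suc m C 2
  pascal = trans (cong (_+ (m C 2)) (sym (nC1≡n m))) (nCk+nC[k+1]≡[n+1]C[k+1] m 1)
  regroup : ∀ m X → 2 * (m + X) + suc m ≡ (2 * X + m) + (2 * m + 1)
  regroup = solve-∀
  square : ∀ m → m * m + (2 * m + 1) ≡ suc m * suc m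
  square = solve-∀

binomial-3 : ∀ n → 6 * (n C 3) + 3 * (n * n) ≡ n * n * n + 2 * n
binomial-3 zero    = refl
binomial-3 (suc m) = begin
  6 * (suc m C 3) + 3 * (suc m * suc m)
    ≡⟨ cong (λ t → 6 * t + 3 * (suc m * suc m)) (sym (nCk+nC[k+1]≡[n+1]C[k+1] m 2)) ⟩
  6 * (m C 2 + m C 3) + 3 * (suc m * suc m)
    ≡⟨ regroup m (m C 2) (m C 3) ⟩
  3 * (2 * (m C 2) + m) + (6 * (m C 3) + 3 * (m * m)) + (3 * m + 3)
    ≡⟨ cong₂ (λ a b → 3 * a + b + (3 * m + 3)) (binomial-2 m) (binomial-3 m) ⟩
  3 * (m * m) + (m * m * m + 2 * m) + (3 * m + 3)
    ≡⟨ cube m ⟩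
  suc m * suc m * suc m + 2 * suc m ∎
  where
  open ≡-Reasoning
  regroup : ∀ m X Y →
    6 * (X + Y) + 3 * (suc m * suc m) ≡ 3 * (2 * X + m) + (6 * Y + 3 * (m * m)) + (3 * m + 3)
  regroup = solve-∀
  cube : ∀ m → 3 * (m * m) + (m * m * m + 2 * m) + (3 * m + 3) ≡ suc m * suc m * suc m + 2 * suc m
  cube = solve-∀

-- n² ≤ 4 C(n,2) for n ≥ 2, since 4 C(n,2) + 2n = 2n² and 2n ≤ n².
square≤4C2 : ∀ n → 2 ≤ n → n * n ≤ 4 * (n C 2)
square≤4C2 (suc zero) (s≤s ())
square≤4C2 n@(suc (suc k)) _ = +-cancelʳ-≤ (2 * n) (n * n) (4 * (n C 2)) (begin
  n * n + 2 * n                       ≤⟨ m≤m+n (n * n + 2 * n) (k * k + 2 * k) ⟩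
  n * n + 2 * n + (k * k + 2 * k)     ≡⟨ expand k ⟩
  2 * (n * n)                         ≡⟨ cong (2 *_) (binomial-2 n) ⟨
  2 * (2 * (n C 2) + n)               ≡⟨ regroup (n C 2) n ⟩
  4 * (n C 2) + 2 * n                 ∎)
  where
  open ≤-Reasoning
  expand : ∀ k → let n = suc (suc k) in n * n + 2 * n + (k * k + 2 * k) ≡ 2 * (n * n)
  expand = solve-∀
  regroup : ∀ X n → 2 * (2 * X + n) ≡ 4 * X + 2 * n
  regroup = solve-∀

-- n³ ≤ 27 C(n,3) for n ≥ 3, since 6 · 27 C(n,3) + 81 n² = 27 (n³ + 2n).
cube≤27C3 : ∀ n → 3 ≤ n → n * n * n ≤ 27 * (n C 3)
cube≤27C3 (suc zero)       (s≤s ())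
cube≤27C3 (suc (suc zero)) (s≤s (s≤s ()))
cube≤27C3 n@(suc (suc (suc k))) _ =
  *-cancelˡ-≤ 6 (+-cancelʳ-≤ (81 * (n * n)) (6 * (n * n * n)) (6 * (27 * (n C 3))) (begin
    6 * (n * n * n) + 81 * (n * n)           ≤⟨ m≤m+n _ slack ⟩
    6 * (n * n * n) + 81 * (n * n) + slack   ≡⟨ expand k ⟩
    27 * (n * n * n + 2 * n)                 ≡⟨ cong (27 *_) (binomial-3 n) ⟨
    27 * (6 * (n C 3) + 3 * (n * n))         ≡⟨ regroup (n C 3) n ⟩
    6 * (27 * (n C 3)) + 81 * (n * n)        ∎))
  where
  open ≤-Reasoning
  slack : ℕ
  slack = 21 * (k * k * k) + 108 * (k * k) + 135 * k
  expand : ∀ k → let n = suc (suc (suc k)) in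
    6 * (n * n * n) + 81 * (n * n) + (21 * (k * k * k) + 108 * (k * k) + 135 * k)
      ≡ 27 * (n * n * n + 2 * n)
  expand = solve-∀
  regroup : ∀ X n → 27 * (6 * X + 3 * (n * n)) ≡ 6 * (27 * X) + 81 * (n * n)
  regroup = solve-∀

^-positive : ∀ {m} k → 0 < m → 0 < m ^ k
^-positive {m} k 0<m = m^n>0 m {{>-nonZero 0<m}} k

m≤m^k : ∀ m {k} → 1 ≤ k → m ≤ m ^ k
m≤m^k zero          _         = z≤n
m≤m^k m@(suc _) {suc k} _ = begin
  m          ≡⟨ *-identityʳ m ⟨
  m * 1      ≤⟨ *-monoʳ-≤ m (^-positive k (s≤s z≤n)) ⟩
  m * m ^ k  ∎
  where open ≤-Reasoning

toℚᵘ-÷ℕ : ∀ a d → ℚ.toℚᵘ (a ÷ℕ suc d) ℚᵘ.≃ ℚᵘ.mkℚᵘ (ℤ.+ a) d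
toℚᵘ-÷ℕ a d = ℚ.toℚᵘ-fromℚᵘ (ℚᵘ.mkℚᵘ (ℤ.+ a) d)

÷ℕ-≤ : ∀ {a b d e} → 0 < d → 0 < e → a * e ≤ b * d → a ÷ℕ d ℚ.≤ b ÷ℕ e
÷ℕ-≤ {a} {b} {suc d} {suc e} _ _ ae≤bd =
  ℚ.toℚᵘ-cancel-≤ (ℚᵘ.≤-respˡ-≃ (ℚᵘ.≃-sym (toℚᵘ-÷ℕ a d)) (ℚᵘ.≤-respʳ-≃ (ℚᵘ.≃-sym (toℚᵘ-÷ℕ b e))
    (ℚᵘ.*≤* (subst₂ ℤ._≤_ (ℤ.pos-* a (suc e)) (ℤ.pos-* b (suc d)) (ℤ.+≤+ ae≤bd)))))

÷ℕ-cong : ∀ {a b d e} → 0 < d → 0 < e → a * e ≡ b * d → a ÷ℕ d ≡ b ÷ℕ e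
÷ℕ-cong 0<d 0<e ae≡bd =
  ℚ.≤-antisym (÷ℕ-≤ 0<d 0<e (≤-reflexive ae≡bd)) (÷ℕ-≤ 0<e 0<d (≤-reflexive (sym ae≡bd)))

÷ℕ-zero : ∀ {d} → 0 < d → 0 ÷ℕ d ≡ 0ℚ
÷ℕ-zero {d} 0<d = ÷ℕ-cong {0} {0} {d} {1} 0<d (s≤s z≤n) refl

÷ℕ-+-÷ℕ : ∀ a b d e → (a ÷ℕ suc d) ℚ.+ (b ÷ℕ suc e) ≡ (a * suc e + b * suc d) ÷ℕ (suc d * suc e)
÷ℕ-+-÷ℕ a b d e = ℚ.toℚᵘ-injective (ℚᵘ.≃-trans (ℚ.toℚᵘ-homo-+ (a ÷ℕ suc d) (b ÷ℕ suc e))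
  (ℚᵘ.≃-trans (ℚᵘ.+-cong (toℚᵘ-÷ℕ a d) (toℚᵘ-÷ℕ b e))
  (ℚᵘ.≃-trans (ℚᵘ.≃-reflexive (cong (λ t → ℚᵘ.mkℚᵘ t _) numerator))
  (ℚᵘ.≃-sym (toℚᵘ-÷ℕ (a * suc e + b * suc d) _)))))
  where
  numerator : ℤ.+ a ℤ.* ℤ.+ suc e ℤ.+ ℤ.+ b ℤ.* ℤ.+ suc d ≡ ℤ.+ (a * suc e + b * suc d)
  numerator =
    sym (trans (ℤ.pos-+ (a * suc e) (b * suc d)) (cong₂ ℤ._+_ (ℤ.pos-* a (suc e)) (ℤ.pos-* b (suc d))))

÷ℕ-+ : ∀ a b {d} → 0 < d → (a + b) ÷ℕ d ≡ (a ÷ℕ d) ℚ.+ (b ÷ℕ d)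
÷ℕ-+ a b {suc d} 0<d = begin
  (a + b) ÷ℕ suc d
    ≡⟨ ÷ℕ-cong {a + b} {a * suc d + b * suc d} 0<d (*-mono-< 0<d 0<d) (distrib a b (suc d)) ⟩
  (a * suc d + b * suc d) ÷ℕ (suc d * suc d)
    ≡⟨ ÷ℕ-+-÷ℕ a b d d ⟨
  (a ÷ℕ suc d) ℚ.+ (b ÷ℕ suc d) ∎
  where
  open ≡-Reasoning
  distrib : ∀ a b d → (a + b) * (d * d) ≡ (a * d + b * d) * d
  distrib = solve-∀

÷ℕ-* : ∀ a {d} → 0 < d → (a ÷ℕ 1) ℚ.* (1 ÷ℕ d) ≡ a ÷ℕ d
÷ℕ-* a {suc d} _ = ℚ.toℚᵘ-injective (ℚᵘ.≃-trans (ℚ.toℚᵘ-homo-* (a ÷ℕ 1) (1 ÷ℕ suc d))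
  (ℚᵘ.≃-trans (ℚᵘ.*-cong (toℚᵘ-÷ℕ a 0) (toℚᵘ-÷ℕ 1 d))
  (ℚᵘ.≃-trans (ℚᵘ.*≡* cross) (ℚᵘ.≃-sym (toℚᵘ-÷ℕ a d)))))
  where
  cross : (ℤ.+ a ℤ.* ℤ.+ 1) ℤ.* ℤ.+ suc d ≡ ℤ.+ a ℤ.* ℤ.+ (1 * suc d)
  cross = cong₂ ℤ._*_ (ℤ.*-identityʳ (ℤ.+ a)) (cong ℤ.+_ (sym (*-identityˡ (suc d))))

sumℚ : List ℚ → ℚ
sumℚ = foldr ℚ._+_ 0ℚ

÷ℕ-sum : ∀ {K : Set} (f : K → ℕ) ks {d} → 0 < d → sum (map f ks) ÷ℕ d ≡ sumℚ (map (λ k → f k ÷ℕ d) ks)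
÷ℕ-sum f []           0<d = ÷ℕ-zero 0<d
÷ℕ-sum f (k ∷ ks) {d} 0<d =
  trans (÷ℕ-+ (f k) (sum (map f ks)) 0<d) (cong ((f k ÷ℕ d) ℚ.+_) (÷ℕ-sum f ks 0<d))

sumℚ-mono : ∀ {K : Set} (ks : List K) {f g : K → ℚ} → (∀ k → k ∈ ks → f k ℚ.≤ g k) →
  sumℚ (map f ks) ℚ.≤ sumℚ (map g ks)
sumℚ-mono []       f≤g = ℚ.≤-refl
sumℚ-mono (k ∷ ks) f≤g = ℚ.+-mono-≤ (f≤g k (here refl)) (sumℚ-mono ks (λ k′ k′∈ → f≤g k′ (there k′∈)))

÷ℕ-monoˡ-≤ : ∀ {a b d} → 0 < d → a ≤ b → a ÷ℕ d ℚ.≤ b ÷ℕ d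
÷ℕ-monoˡ-≤ {d = d} 0<d a≤b = ÷ℕ-≤ 0<d 0<d (*-monoˡ-≤ d a≤b)

sumℚ-≤-count : ∀ {K : Set} (ks : List K) (f : K → ℚ) {d} → 0 < d → (∀ k → k ∈ ks → f k ℚ.≤ 1 ÷ℕ d) →
  sumℚ (map f ks) ℚ.≤ length ks ÷ℕ d
sumℚ-≤-count ks f {d} 0<d f≤1/d = begin
  sumℚ (map f ks)                 ≤⟨ sumℚ-mono ks f≤1/d ⟩
  sumℚ (map (λ _ → 1 ÷ℕ d) ks)    ≡⟨ ÷ℕ-sum (λ _ → 1) ks 0<d ⟨
  sum (map (λ _ → 1) ks) ÷ℕ d     ≡⟨ cong (_÷ℕ d) (trans (sum-const ks 1) (*-identityʳ (length ks))) ⟩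
  length ks ÷ℕ d                  ∎
  where open ℚ.≤-Reasoning

nonTransitiveBound-÷ : ∀ {n r} L → r ≤ n →
  nonTransitiveBound n (suc L) r ÷ℕ ((n !) ^ suc L) ≡ 1 ÷ℕ ((n C r) ^ L)
nonTransitiveBound-÷ {n} {r} L r≤n =
  ÷ℕ-cong (^-positive (suc L) (1≤n! n)) (^-positive L (binomial-pos r≤n)) (begin
    (n C r) * X ^ suc L * (n C r) ^ L ≡⟨ regroup (n C r) (X ^ suc L) ((n C r) ^ L) ⟩
    (n C r) ^ suc L * X ^ suc L       ≡⟨ *-^ (n C r) X (suc L) ⟨
    ((n C r) * X) ^ suc L             ≡⟨ cong (_^ suc L) (binomial-factorials r≤n) ⟩
    (n !) ^ suc L                     ≡⟨ *-identityˡ _ ⟨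
    1 * (n !) ^ suc L                 ∎)
  where
  open ≡-Reasoning
  X : ℕ
  X = r ! * (n ∸ r) !
  regroup : ∀ C Y Z → C * Y * Z ≡ C * Z * Y
  regroup = solve-∀

nonTransitive-proportion : ∀ L n (xs : List (Tuple n (suc L))) → Unique xs →
  All (λ gs → AllPerm gs × ¬ Transitive gs) xs → (length xs ÷ℕ ((n !) ^ suc L)) ℚ.≤ boundSum n (suc L)
nonTransitive-proportion L n xs xs! nonTransitive = begin
  length xs ÷ℕ D
    ≤⟨ ÷ℕ-monoˡ-≤ 0<D (atMost-nonTransitive n (suc L) xs xs! nonTransitive) ⟩
  sum (map (nonTransitiveBound n (suc L)) range) ÷ℕ D
    ≡⟨ ÷ℕ-sum (nonTransitiveBound n (suc L)) range 0<D ⟩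
  sumℚ (map (λ r → nonTransitiveBound n (suc L) r ÷ℕ D) range)
    ≡⟨ cong sumℚ (List.map-cong-local (All.tabulate λ r∈ → nonTransitiveBound-÷ L (r≤n r∈))) ⟩
  boundSum n (suc L) ∎
  where
  open ℚ.≤-Reasoning
  D : ℕ
  D = (n !) ^ suc L
  0<D : 0 < D
  0<D = ^-positive (suc L) (1≤n! n)
  range : List ℕ
  range = applyUpTo suc (n / 2)
  r≤n : ∀ {r} → r ∈ range → r ≤ n
  r≤n r∈ = ≤-trans (∈-upToHalf {n} r∈) (m/n≤m n 2)

-- Asymptotics of boundSum n (L + 1) for L ≥ 1 and n ≥ 6: the term r = 1 is exactly n^(-L),
-- the term r = 2 is at most 4^L n^(-L-1), and each of the fewer than n terms with r ≥ 3 is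
-- at most C(n,3)^(-L) ≤ 27^L n^(-3L), so together they contribute at most 27^L n^(-L-1).
module Asymptotics (L : ℕ) (1≤L : 1 ≤ L) (n : ℕ) (6≤n : 6 ≤ n) where

  2≤n : 2 ≤ n
  2≤n = ≤-trans (s≤s (s≤s z≤n)) 6≤n

  3≤n : 3 ≤ n
  3≤n = ≤-trans (s≤s (s≤s (s≤s z≤n))) 6≤n

  n≤n^L : n ≤ n ^ L
  n≤n^L = m≤m^k n 1≤L

  D : ℕ
  D = n ^ suc L

  0<D : 0 < D
  0<D = ^-positive (suc L) (≤-trans (s≤s z≤n) 2≤n)

  0<C[n,r]^L : ∀ {r} → r ≤ n → 0 < (n C r) ^ L
  0<C[n,r]^L r≤n = ^-positive L (binomial-pos r≤n)

  term : ℕ → ℚ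
  term r = 1 ÷ℕ ((n C r) ^ L)

  term-1 : term 1 ≡ 1 ÷ℕ (n ^ L)
  term-1 = cong (λ t → 1 ÷ℕ (t ^ L)) (nC1≡n n)

  term-2 : term 2 ℚ.≤ (4 ^ L) ÷ℕ D
  term-2 = ÷ℕ-≤ (0<C[n,r]^L 2≤n) 0<D (begin
    1 * (n * n ^ L)      ≡⟨ *-identityˡ _ ⟩
    n * n ^ L            ≤⟨ *-monoˡ-≤ (n ^ L) n≤n^L ⟩
    n ^ L * n ^ L        ≡⟨ *-^ n n L ⟨
    (n * n) ^ L          ≤⟨ ^-monoˡ-≤ L (square≤4C2 n 2≤n) ⟩
    (4 * (n C 2)) ^ L    ≡⟨ *-^ 4 (n C 2) L ⟩
    4 ^ L * (n C 2) ^ L  ∎)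
    where open ≤-Reasoning

  term-≥3 : ∀ {r} → 3 ≤ r → r ≤ n / 2 → term r ℚ.≤ 1 ÷ℕ ((n C 3) ^ L)
  term-≥3 3≤r r≤n/2 = ÷ℕ-≤ (0<C[n,r]^L (≤-trans r≤n/2 (m/n≤m n 2))) (0<C[n,r]^L 3≤n)
    (*-monoʳ-≤ 1 (^-monoˡ-≤ L (binomial-mono n 3 _ 3≤r (+-≤-halves 3≤r r≤n/2))))

  terms-≥3 : ∀ {k} → k ≤ n → k ÷ℕ ((n C 3) ^ L) ℚ.≤ (27 ^ L) ÷ℕ D
  terms-≥3 {k} k≤n = ÷ℕ-≤ (0<C[n,r]^L 3≤n) 0<D (begin
    k * (n * n ^ L)             ≤⟨ *-monoˡ-≤ _ k≤n ⟩
    n * (n * n ^ L)             ≤⟨ *-mono-≤ n≤n^L (*-monoˡ-≤ (n ^ L) n≤n^L) ⟩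
    n ^ L * (n ^ L * n ^ L)     ≡⟨ cube ⟨
    (n * n * n) ^ L             ≤⟨ ^-monoˡ-≤ L (cube≤27C3 n 3≤n) ⟩
    (27 * (n C 3)) ^ L          ≡⟨ *-^ 27 (n C 3) L ⟩
    27 ^ L * (n C 3) ^ L        ∎)
    where
    open ≤-Reasoning
    cube : (n * n * n) ^ L ≡ n ^ L * (n ^ L * n ^ L)
    cube = trans (*-^ (n * n) n L) (trans (cong (_* n ^ L) (*-^ n n L)) (*-assoc (n ^ L) (n ^ L) (n ^ L)))

  partialSum-bound : ∀ h → 2 ≤ h → h ≤ n / 2 →
    sumℚ (map term (applyUpTo suc h)) ℚ.≤ (1 ÷ℕ (n ^ L)) ℚ.+ ((4 ^ L) ÷ℕ D ℚ.+ (27 ^ L) ÷ℕ D)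
  partialSum-bound (suc zero)    (s≤s ()) _
  partialSum-bound (suc (suc k)) _        h≤n/2 =
    ℚ.+-mono-≤ (ℚ.≤-reflexive term-1) (ℚ.+-mono-≤ term-2 (begin
      sumℚ (map term later)           ≤⟨ sumℚ-≤-count later term (0<C[n,r]^L 3≤n) later-term ⟩
      length later ÷ℕ ((n C 3) ^ L)   ≤⟨ terms-≥3 (subst (_≤ n) (sym (List.length-applyUpTo _ k)) k≤n) ⟩
      (27 ^ L) ÷ℕ D                   ∎))
    where
    open ℚ.≤-Reasoning
    later : List ℕ
    later = applyUpTo (λ i → 3 + i) k
    k≤n : k ≤ n
    k≤n = ≤-trans (m≤n+m k 2) (≤-trans h≤n/2 (m/n≤m n 2))
    later-term : ∀ r → r ∈ later → term r ℚ.≤ 1 ÷ℕ ((n C 3) ^ L)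
    later-term r r∈ with ∈-applyUpTo⁻ (λ i → 3 + i) r∈
    ... | i , i<k , refl = term-≥3 (m≤m+n 3 i) (≤-trans (s≤s (s≤s i<k)) h≤n/2)

  boundSum-bound : boundSum n (suc L) ℚ.≤ (1 ÷ℕ (n ^ L)) ℚ.+ ((4 ^ L + 27 ^ L) ÷ℕ 1) ℚ.* (1 ÷ℕ D)
  boundSum-bound = begin
    boundSum n (suc L)
      ≤⟨ partialSum-bound (n / 2) (/-monoˡ-≤ 2 (≤-trans (s≤s (s≤s (s≤s (s≤s z≤n)))) 6≤n)) ≤-refl ⟩
    (1 ÷ℕ (n ^ L)) ℚ.+ ((4 ^ L) ÷ℕ D ℚ.+ (27 ^ L) ÷ℕ D)
      ≡⟨ cong ((1 ÷ℕ (n ^ L)) ℚ.+_) (trans (÷ℕ-* (4 ^ L + 27 ^ L) 0<D) (÷ℕ-+ (4 ^ L) (27 ^ L) 0<D)) ⟨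
    (1 ÷ℕ (n ^ L)) ℚ.+ ((4 ^ L + 27 ^ L) ÷ℕ 1) ℚ.* (1 ÷ℕ D) ∎
    where open ℚ.≤-Reasoning

lemma3p9 : (l : ℕ) → 2 ≤ l →
    ((n : ℕ) → (xs : List (Tuple n l)) → Unique xs →
      All (λ gs → AllPerm gs × ¬ Transitive gs) xs →
      (length xs ÷ℕ ((n !) ^ l)) ℚ.≤ boundSum n l)
    × Σ ℚ (λ C → Σ ℕ (λ N → (n : ℕ) → N ≤ n →
      boundSum n l ℚ.≤ (1 ÷ℕ (n ^ (l ∸ 1))) ℚ.+ C ℚ.* (1 ÷ℕ (n ^ l))))
lemma3p9 (suc L) (s≤s 1≤L) =
    nonTransitive-proportion L
  , (4 ^ L + 27 ^ L) ÷ℕ 1 , 6 , λ n 6≤n → Asymptotics.boundSum-bound L 1≤L n 6≤n
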